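{- Let $m\ge 4$ be even and $1\le a\le b<\frac m2$ be integers such that (i) $m\equiv 2\pmod 4$; (ii) $a$ and $b$ are both even; (iii) $\gcd(\frac m2,a,b)=1$; (iv) if $5\mid m$, then at least one of $a,b,a-b,a+b$ is divisible by $5$. Let $p\ge 11$ be a prime with $p\mid m$. Then $\Phi_p(x)$ does not divide $R_{a,b}(x)=x^{2a+2b}+x^{2a}+x^{2b}+1+x^{2a+b}+x^{a+2b}+x^a+x^b$, and $\Phi_{2p}(x)$ does not divide $Q_{a,b}(x)=x^{2a+2b}+x^{2a}+x^{2b}+1-x^{2a+b}-x^{a+2b}-x^a-x^b$.
   Context: $\Phi_f(x)$ denotes the $f$-th cyclotomic polynomial. -}

module Defs where

open import Data.Nat as ℕ using (ℕ; zero; suc)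
open import Data.Nat.Divisibility using (_∣?_)
open import Data.Integer as ℤ using (ℤ; +_; -_)
open import Data.List using (List; []; _∷_; foldr; map; filter; applyUpTo)
open import Data.Product using (∃)
open import Relation.Binary.PropositionalEquality using (_≡_)

-- Polynomials with integer coefficients, as coefficient lists,
-- lowest degree first (trailing zeros allowed).
Poly : Set
Poly = List ℤ

coeff : Poly → ℕ → ℤ
coeff []       _       = + 0
coeff (c ∷ cs) zero    = c
coeff (c ∷ cs) (suc i) = coeff cs i

infix 4 _≈ₚ_
_≈ₚ_ : Poly → Poly → Set
p ≈ₚ q = ∀ i → coeff p i ≡ coeff q i

infixl 6 _+ₚ_ _-ₚ_
infixl 7 _*ₚ_ _·ₚ_

_+ₚ_ : Poly → Poly → Poly
[]       +ₚ q        = q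
(c ∷ cs) +ₚ []       = c ∷ cs
(c ∷ cs) +ₚ (d ∷ ds) = (c ℤ.+ d) ∷ (cs +ₚ ds)

_·ₚ_ : ℤ → Poly → Poly
c ·ₚ p = map (c ℤ.*_) p

negₚ : Poly → Poly
negₚ p = (- + 1) ·ₚ p

_-ₚ_ : Poly → Poly → Poly
p -ₚ q = p +ₚ negₚ q

_*ₚ_ : Poly → Poly → Poly
[]       *ₚ q = []
(c ∷ cs) *ₚ q = (c ·ₚ q) +ₚ (+ 0 ∷ (cs *ₚ q))

oneₚ : Poly
oneₚ = + 1 ∷ []

X^ : ℕ → Poly
X^ zero    = oneₚ
X^ (suc k) = + 0 ∷ X^ k

infix 4 _∣ₚ_
_∣ₚ_ : Poly → Poly → Set
d ∣ₚ r = ∃ λ q → d *ₚ q ≈ₚ r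

prodₚ : List Poly → Poly
prodₚ = foldr _*ₚ_ oneₚ

divisors : ℕ → List ℕ
divisors n = filter (_∣? n) (applyUpTo suc n)

-- Φ is the family of cyclotomic polynomials: the (unique) family in ℤ[x]
-- with  x^n − 1 = ∏_{d ∣ n} Φ_d(x)  for every n ≥ 1.
IsCyclotomicFamily : (ℕ → Poly) → Set
IsCyclotomicFamily Φ = ∀ n → 1 ℕ.≤ n → X^ n -ₚ oneₚ ≈ₚ prodₚ (map Φ (divisors n))

R : ℕ → ℕ → Poly
R a b = X^ (2 ℕ.* a ℕ.+ 2 ℕ.* b) +ₚ X^ (2 ℕ.* a) +ₚ X^ (2 ℕ.* b) +ₚ oneₚ
        +ₚ X^ (2 ℕ.* a ℕ.+ b) +ₚ X^ (a ℕ.+ 2 ℕ.* b) +ₚ X^ a +ₚ X^ b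

Q : ℕ → ℕ → Poly
Q a b = X^ (2 ℕ.* a ℕ.+ 2 ℕ.* b) +ₚ X^ (2 ℕ.* a) +ₚ X^ (2 ℕ.* b) +ₚ oneₚ
        -ₚ X^ (2 ℕ.* a ℕ.+ b) -ₚ X^ (a ℕ.+ 2 ℕ.* b) -ₚ X^ a -ₚ X^ b

module Submission where

-- Everything is reduced to evaluations at integers: a polynomial vanishing at every integer t ≥ 2
-- is zero, and there the cyclotomic identities can be divided by t - 1 and tᵖ - 1.  This gives
-- Φₚ(x) = 1 + x + ⋯ + x^(p-1) and, p being odd, Φ₂ₚ(x) = Φₚ(-x).
--
-- For R: a factorisation R = Φₚ q evaluated at 1 gives 8 = p q(1), impossible for odd p.
--
-- For Q: since a and b are even, Q(x) = Q(-x), so Φ₂ₚ ∣ Q yields Q = Φₚ g and hence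
-- (x - 1) Q = (xᵖ - 1) g.  Summing the coefficients of both sides over an exponent class mod p
-- shows that all these class sums of Q are equal.  Depending on which of
-- a, b, 2a + b, a + 2b are divisible by p (not both a and b, by the gcd condition), the class of a,
-- of b or of 2a differs from the class of 0 in the number of + and - monomials it contains; this
-- uses that p does not divide 2, 4 or 5.

open import Defs
open import Data.Nat using (ℕ; NonZero; _<_)
open import Data.Nat.Primality using (Prime)
open import Relation.Binary.PropositionalEquality using (_≢_)

module Coefficients where
  open import Data.Nat using (zero; suc; _≤_; s≤s)
  open import Data.Integer using (+_; _+_; _*_; _-_; -1ℤ)
  open import Data.Integer.Properties using (+-identityˡ; +-identityʳ; *-zeroʳ; -1*i≡-i)
  open import Data.List using ([]; _∷_; length)
  open import Relation.Binary.PropositionalEquality using (_≡_; refl; cong; sym; trans)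

  coeff-+ₚ : ∀ f g i → coeff (f +ₚ g) i ≡ coeff f i + coeff g i
  coeff-+ₚ []       g        i       = sym (+-identityˡ _)
  coeff-+ₚ (c ∷ cs) []       i       = sym (+-identityʳ _)
  coeff-+ₚ (c ∷ cs) (d ∷ ds) zero    = refl
  coeff-+ₚ (c ∷ cs) (d ∷ ds) (suc i) = coeff-+ₚ cs ds i

  coeff-·ₚ : ∀ c f i → coeff (c ·ₚ f) i ≡ c * coeff f i
  coeff-·ₚ c []       i       = sym (*-zeroʳ c)
  coeff-·ₚ c (d ∷ ds) zero    = refl
  coeff-·ₚ c (d ∷ ds) (suc i) = coeff-·ₚ c ds i

  coeff-minusₚ : ∀ f g i → coeff (f -ₚ g) i ≡ coeff f i - coeff g i
  coeff-minusₚ f g i = trans (coeff-+ₚ f (negₚ g) i)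
    (cong (_+_ (coeff f i)) (trans (coeff-·ₚ -1ℤ g i) (-1*i≡-i _)))

  coeff-X^-≡ : ∀ e → coeff (X^ e) e ≡ + 1
  coeff-X^-≡ zero    = refl
  coeff-X^-≡ (suc e) = coeff-X^-≡ e

  coeff-X^-≢ : ∀ e i → e ≢ i → coeff (X^ e) i ≡ + 0
  coeff-X^-≢ zero    zero    e≢i = contradiction refl e≢i
    where open import Relation.Nullary using (contradiction)
  coeff-X^-≢ zero    (suc i) _   = refl
  coeff-X^-≢ (suc e) zero    _   = refl
  coeff-X^-≢ (suc e) (suc i) e≢i = coeff-X^-≢ e i (e≢i ∘ cong suc)
    where open import Function using (_∘_)

  coeff-≥length : ∀ f i → length f ≤ i → coeff f i ≡ + 0
  coeff-≥length []       i       _         = refl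
  coeff-≥length (c ∷ cs) (suc i) (s≤s l≤i) = coeff-≥length cs i l≤i

module Evaluation where
  open Coefficients using (coeff-minusₚ)
  open import Data.Nat as ℕ using (zero; suc)
  open import Data.Nat.Divisibility using (_∣_; >⇒∤)
  open import Data.Nat.Properties using (m≤n+m)
  open import Data.Integer using (ℤ; +_; -_; _+_; _*_; _-_; _^_; 0ℤ; 1ℤ; -1ℤ; ∣_∣)
  open import Data.Integer.Properties
    using ( +-identityˡ; +-identityʳ; *-zeroʳ; +-inverseʳ; -1*i≡-i
          ; ∣i∣≡0⇒i≡0; i*j≡0⇒i≡0∨j≡0; i-j≡0⇒i≡j )
  open import Data.Integer.Tactic.RingSolver using (solve-∀)
  open import Data.Integer.Divisibility.Signed using (divides; ∣⇒∣ᵤ)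
  open import Data.List using ([]; _∷_)
  open import Data.Sum using (inj₂)
  open import Function using (_∘_)
  open import Relation.Nullary using (contradiction)
  open import Relation.Binary.PropositionalEquality using (_≡_; refl; cong; cong₂; sym; trans)

  eval : ℤ → Poly → ℤ
  eval t []       = 0ℤ
  eval t (c ∷ cs) = c + t * eval t cs

  eval-+ₚ : ∀ t f g → eval t (f +ₚ g) ≡ eval t f + eval t g
  eval-+ₚ t []       g        = sym (+-identityˡ _)
  eval-+ₚ t (c ∷ cs) []       = sym (+-identityʳ _)
  eval-+ₚ t (c ∷ cs) (d ∷ ds) =
    trans (cong (λ v → c + d + t * v) (eval-+ₚ t cs ds)) (regroup c d t _ _)
    where
    regroup : ∀ c d t x y → c + d + t * (x + y) ≡ c + t * x + (d + t * y)
    regroup = solve-∀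

  eval-·ₚ : ∀ t c f → eval t (c ·ₚ f) ≡ c * eval t f
  eval-·ₚ t c []       = sym (*-zeroʳ c)
  eval-·ₚ t c (d ∷ ds) =
    trans (cong (λ v → c * d + t * v) (eval-·ₚ t c ds)) (regroup c d t _)
    where
    regroup : ∀ c d t x → c * d + t * (c * x) ≡ c * (d + t * x)
    regroup = solve-∀

  eval-minusₚ : ∀ t f g → eval t (f -ₚ g) ≡ eval t f - eval t g
  eval-minusₚ t f g = trans (eval-+ₚ t f (negₚ g))
    (cong (_+_ (eval t f)) (trans (eval-·ₚ t -1ℤ g) (-1*i≡-i _)))

  eval-*ₚ : ∀ t f g → eval t (f *ₚ g) ≡ eval t f * eval t g
  eval-*ₚ t []       g = refl
  eval-*ₚ t (c ∷ cs) g = trans (eval-+ₚ t (c ·ₚ g) (+ 0 ∷ cs *ₚ g))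
    (trans (cong₂ (λ u v → u + (0ℤ + t * v)) (eval-·ₚ t c g) (eval-*ₚ t cs g))
           (regroup c t _ _))
    where
    regroup : ∀ c t x y → c * y + (0ℤ + t * (x * y)) ≡ (c + t * x) * y
    regroup = solve-∀

  eval-X^ : ∀ t n → eval t (X^ n) ≡ t ^ n
  eval-X^ t zero    = cong (_+_ 1ℤ) (*-zeroʳ t)
  eval-X^ t (suc n) = trans (+-identityˡ _) (cong (t *_) (eval-X^ t n))

  eval-oneₚ : ∀ t → eval t oneₚ ≡ 1ℤ
  eval-oneₚ t = eval-X^ t 0

  private
    eval-zero : ∀ t f → [] ≈ₚ f → eval t f ≡ 0ℤ
    eval-zero t []       _   = refl
    eval-zero t (c ∷ cs) 0≈f = trans
      (cong₂ (λ u v → u + t * v) (sym (0≈f 0)) (eval-zero t cs (0≈f ∘ suc)))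
      (cong (_+_ 0ℤ) (*-zeroʳ t))

  eval-cong : ∀ t f g → f ≈ₚ g → eval t f ≡ eval t g
  eval-cong t []       g        f≈g = sym (eval-zero t g f≈g)
  eval-cong t (c ∷ cs) []       f≈g = eval-zero t (c ∷ cs) (sym ∘ f≈g)
  eval-cong t (c ∷ cs) (d ∷ ds) f≈g =
    cong₂ (λ u v → u + t * v) (f≈g 0) (eval-cong t cs ds (f≈g ∘ suc))

  -- At t = 2 + ∣c∣ the constant term c = - t f₁(t) is a multiple of t exceeding ∣c∣.
  vanishing⇒zero : ∀ f → (∀ n → eval (+ (2 ℕ.+ n)) f ≡ 0ℤ) → ∀ i → coeff f i ≡ 0ℤ
  vanishing⇒zero []       _   _       = refl
  vanishing⇒zero (c ∷ cs) f≡0 zero    = ∣i∣≡0⇒i≡0 (too-small ∣ c ∣ t∣c)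
    where
    t : ℤ
    t = + (2 ℕ.+ ∣ c ∣)
    isolate : ∀ c t x → c + t * x ≡ 0ℤ → c ≡ (- x) * t
    isolate c t x eq = trans (regroup c t x) (trans (cong (_+ (- x) * t) eq) (+-identityˡ _))
      where
      regroup : ∀ c t x → c ≡ c + t * x + (- x) * t
      regroup = solve-∀
    t∣c : 2 ℕ.+ ∣ c ∣ ∣ ∣ c ∣
    t∣c = ∣⇒∣ᵤ (divides (- eval t cs) (isolate c t _ (f≡0 ∣ c ∣)))
    too-small : ∀ n → 2 ℕ.+ n ∣ n → n ≡ 0
    too-small zero    _ = refl
    too-small (suc n) d = contradiction d (>⇒∤ (ℕ.s≤s (m≤n+m (suc n) 1)))
  vanishing⇒zero (c ∷ cs) f≡0 (suc i) = vanishing⇒zero cs cs≡0 i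
    where
    t*cs≡0 : ∀ n → + (2 ℕ.+ n) * eval (+ (2 ℕ.+ n)) cs ≡ 0ℤ
    t*cs≡0 n = trans (sym (+-identityˡ _))
      (trans (cong (_+ _) (sym (vanishing⇒zero (c ∷ cs) f≡0 0))) (f≡0 n))
    cs≡0 : ∀ n → eval (+ (2 ℕ.+ n)) cs ≡ 0ℤ
    cs≡0 n with i*j≡0⇒i≡0∨j≡0 (+ (2 ℕ.+ n)) (t*cs≡0 n)
    ... | inj₂ cs≡0 = cs≡0

  ≈ₚ-fromEval : ∀ f g → (∀ n → eval (+ (2 ℕ.+ n)) f ≡ eval (+ (2 ℕ.+ n)) g) → f ≈ₚ g
  ≈ₚ-fromEval f g f≡g i = i-j≡0⇒i≡j _ _ (trans (sym (coeff-minusₚ f g i))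
    (vanishing⇒zero (f -ₚ g)
      (λ n → trans (eval-minusₚ _ f g) (trans (cong (_- _) (f≡g n)) (+-inverseʳ (eval _ g)))) i))
module Divisors where
  open import Data.Nat
  open import Data.Nat.Properties
  open import Data.Nat.Divisibility
  open import Data.Nat.Primality using (Prime; prime⇒irreducible; prime⇒nonZero; prime⇒nonTrivial)
  open import Data.Nat.Coprimality using (Coprime; coprime-divisor)
  open import Data.List using (List; []; _∷_; [_]; _++_; filter; applyUpTo)
  open import Data.List.Properties using (filter-++; filter-accept; filter-reject; applyUpTo-∷ʳ; ++-identityʳ)
  open import Data.Product using (_,_)
  open import Data.Sum using (_⊎_; inj₁; inj₂)
  open import Relation.Nullary using (¬_; yes; no; contradiction)
  open import Relation.Binary.PropositionalEquality using (_≡_; refl; sym; trans; cong; subst; module ≡-Reasoning)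

  divisorsUpTo : ℕ → ℕ → List ℕ
  divisorsUpTo n k = filter (_∣? n) (applyUpTo suc k)

  private
    divisorsUpTo-suc : ∀ n k → divisorsUpTo n (suc k) ≡ divisorsUpTo n k ++ filter (_∣? n) [ suc k ]
    divisorsUpTo-suc n k = trans (cong (filter (_∣? n)) (sym (applyUpTo-∷ʳ suc k)))
                                 (filter-++ (_∣? n) (applyUpTo suc k) [ suc k ])

  divisorsUpTo-∣ : ∀ {n k} → suc k ∣ n → divisorsUpTo n (suc k) ≡ divisorsUpTo n k ++ [ suc k ]
  divisorsUpTo-∣ {n} {k} k+1∣n =
    trans (divisorsUpTo-suc n k) (cong (divisorsUpTo n k ++_) (filter-accept (_∣? n) k+1∣n))

  divisorsUpTo-∤ : ∀ {n k} → ¬ suc k ∣ n → divisorsUpTo n (suc k) ≡ divisorsUpTo n k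
  divisorsUpTo-∤ {n} {k} k+1∤n = trans (divisorsUpTo-suc n k)
    (trans (cong (divisorsUpTo n k ++_) (filter-reject (_∣? n) k+1∤n)) (++-identityʳ _))

  divisorsUpTo-gap : ∀ {n k j} → k ≤′ j → (∀ {i} → k < i → i ≤ j → ¬ i ∣ n) →
                     divisorsUpTo n j ≡ divisorsUpTo n k
  divisorsUpTo-gap ≤′-refl          _    = refl
  divisorsUpTo-gap (≤′-step k≤′j) none = trans (divisorsUpTo-∤ (none (s≤s (≤′⇒≤ k≤′j)) ≤-refl))
    (divisorsUpTo-gap k≤′j (λ k<i i≤j → none k<i (m≤n⇒m≤1+n i≤j)))

  divisorsUpTo-next : ∀ {n k j} → k < j → (∀ {i} → k < i → i < j → ¬ i ∣ n) → j ∣ n →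
                      divisorsUpTo n j ≡ divisorsUpTo n k ++ [ j ]
  divisorsUpTo-next {n} {k} {suc j} (s≤s k≤j) none j+1∣n = trans (divisorsUpTo-∣ j+1∣n)
    (cong (_++ [ suc j ]) (divisorsUpTo-gap (≤⇒≤′ k≤j) (λ k<i i≤j → none k<i (s≤s i≤j))))

  private
    no-divisor-below-1 : ∀ {n i} → 0 < i → i < 1 → ¬ i ∣ n
    no-divisor-below-1 (s≤s z≤n) (s≤s ())

  divisorsUpTo-1 : ∀ n → divisorsUpTo n 1 ≡ [ 1 ]
  divisorsUpTo-1 n = divisorsUpTo-next (s≤s z≤n) no-divisor-below-1 (1∣ n)

  divisors-prime : ∀ {p} → Prime p → divisors p ≡ 1 ∷ p ∷ []
  divisors-prime {p} pp = trans (divisorsUpTo-next 1<p none ∣-refl) (cong (_++ [ p ]) (divisorsUpTo-1 p))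
    where
    1<p : 1 < p
    1<p = nonTrivial⇒n>1 p {{prime⇒nonTrivial pp}}
    none : ∀ {i} → 1 < i → i < p → ¬ i ∣ p
    none 1<i i<p i∣p with prime⇒irreducible pp i∣p
    ... | inj₁ refl = <-irrefl refl 1<i
    ... | inj₂ refl = <-irrefl refl i<p

  ∣2*p⇒∣2⊎p∣ : ∀ {p i} → Prime p → i ∣ 2 * p → i ∣ 2 ⊎ p ∣ i
  ∣2*p⇒∣2⊎p∣ {p} {i} pp i∣2p with p ∣? i
  ... | yes p∣i = inj₂ p∣i
  ... | no  p∤i = inj₁ (coprime-divisor i⊥p (subst (i ∣_) (*-comm 2 p) i∣2p))
    where
    i⊥p : Coprime i p
    i⊥p (d∣i , d∣p) with prime⇒irreducible pp d∣p
    ... | inj₁ d≡1 = d≡1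
    ... | inj₂ refl = contradiction d∣i p∤i

  divisors-2*prime : ∀ {p} → Prime p → 2 < p → divisors (2 * p) ≡ 1 ∷ 2 ∷ p ∷ 2 * p ∷ []
  divisors-2*prime {p} pp 2<p = begin
    divisorsUpTo (2 * p) (2 * p)           ≡⟨ divisorsUpTo-next p<2p between-p-2p ∣-refl ⟩
    divisorsUpTo (2 * p) p ++ [ 2 * p ]    ≡⟨ cong (_++ [ 2 * p ]) (divisorsUpTo-next 2<p between-2-p (n∣m*n 2)) ⟩
    (divisorsUpTo (2 * p) 2 ++ [ p ]) ++ [ 2 * p ]
      ≡⟨ cong (λ ds → (ds ++ [ p ]) ++ [ 2 * p ])
              (divisorsUpTo-next (s≤s (s≤s z≤n)) no-divisor-between-1-2 (m∣m*n p)) ⟩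
    ((divisorsUpTo (2 * p) 1 ++ [ 2 ]) ++ [ p ]) ++ [ 2 * p ]
      ≡⟨ cong (λ ds → ((ds ++ [ 2 ]) ++ [ p ]) ++ [ 2 * p ]) (divisorsUpTo-1 (2 * p)) ⟩
    1 ∷ 2 ∷ p ∷ 2 * p ∷ [] ∎
    where
    open ≡-Reasoning
    p<2p : p < 2 * p
    p<2p = subst (p <_) (*-comm p 2) (m<m*n p 2 {{prime⇒nonZero pp}} (s≤s (s≤s z≤n)))
    no-divisor-between-1-2 : ∀ {n i} → 1 < i → i < 2 → ¬ i ∣ n
    no-divisor-between-1-2 (s≤s (s≤s z≤n)) (s≤s (s≤s ()))
    between-2-p : ∀ {i} → 2 < i → i < p → ¬ i ∣ 2 * p
    between-2-p {i} 2<i i<p i∣2p with ∣2*p⇒∣2⊎p∣ pp i∣2p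
    ... | inj₁ i∣2 = <⇒≱ 2<i (∣⇒≤ i∣2)
    ... | inj₂ p∣i = <⇒≱ i<p (∣⇒≤ {{>-nonZero (<-trans (s≤s z≤n) 2<i)}} p∣i)
    between-p-2p : ∀ {i} → p < i → i < 2 * p → ¬ i ∣ 2 * p
    between-p-2p {i} p<i i<2p i∣2p with ∣2*p⇒∣2⊎p∣ pp i∣2p
    ... | inj₁ i∣2 = <⇒≱ (<-trans 2<p p<i) (∣⇒≤ i∣2)
    ... | inj₂ (divides e refl) = <⇒≱ 1<e (s≤s⁻¹ e<2)
      where
      1<e : 1 < e
      1<e = *-cancelʳ-< p 1 e (subst (_< e * p) (sym (*-identityˡ p)) p<i)
      e<2 : e < 2
      e<2 = *-cancelʳ-< p e 2 i<2p

module SpecialPolynomials where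
  open Evaluation
  open import Data.Nat as ℕ using (zero; suc; _<_; s≤s)
  open import Data.Nat.Divisibility using (_∣_; divides)
  open import Data.Integer using (+_; -_; _+_; _*_; _-_; _^_; 1ℤ; -1ℤ)
  open import Data.Integer.Properties using (+-identityˡ; *-identityˡ; *-zeroʳ; *-assoc; neg-distribˡ-*)
  open import Data.Integer.Tactic.RingSolver using (solve-∀)
  open import Data.List using ([]; _∷_; replicate)
  open import Relation.Binary.PropositionalEquality using (_≡_; refl; cong; sym; trans; module ≡-Reasoning)
  open ≡-Reasoning

  geometric : ℕ → Poly
  geometric n = replicate n (+ 1)

  eval-geometric : ∀ t n → (t - 1ℤ) * eval t (geometric n) ≡ t ^ n - 1ℤ
  eval-geometric t zero    = *-zeroʳ (t - 1ℤ)
  eval-geometric t (suc n) = trans (expand t (eval t (geometric n)))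
    (trans (cong (λ v → t - 1ℤ + t * v) (eval-geometric t n)) (collapse t (t ^ n)))
    where
    expand : ∀ t x → (t - 1ℤ) * (1ℤ + t * x) ≡ t - 1ℤ + t * ((t - 1ℤ) * x)
    expand = solve-∀
    collapse : ∀ t y → t - 1ℤ + t * (y - 1ℤ) ≡ t * y - 1ℤ
    collapse = solve-∀

  eval-geometric-1 : ∀ n → eval 1ℤ (geometric n) ≡ + n
  eval-geometric-1 zero    = refl
  eval-geometric-1 (suc n) = cong (_+_ 1ℤ) (trans (*-identityˡ _) (eval-geometric-1 n))

  alt : Poly → Poly
  alt []       = []
  alt (c ∷ cs) = c ∷ negₚ (alt cs)

  eval-alt : ∀ t f → eval t (alt f) ≡ eval (- t) f
  eval-alt t []       = refl
  eval-alt t (c ∷ cs) = trans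
    (cong (λ v → c + t * v) (trans (eval-·ₚ t -1ℤ (alt cs)) (cong (-1ℤ *_) (eval-alt t cs))))
    (regroup c t (eval (- t) cs))
    where
    regroup : ∀ c t x → c + t * (-1ℤ * x) ≡ c + (- t) * x
    regroup = solve-∀

  shift : ℕ → Poly → Poly
  shift zero    f = f
  shift (suc n) f = + 0 ∷ shift n f

  eval-shift : ∀ t n f → eval t (shift n f) ≡ t ^ n * eval t f
  eval-shift t zero    f = sym (*-identityˡ _)
  eval-shift t (suc n) f = trans (+-identityˡ _)
    (trans (cong (t *_) (eval-shift t n f)) (sym (*-assoc t _ _)))

  coeff-shift-< : ∀ n f i → i < n → coeff (shift n f) i ≡ + 0
  coeff-shift-< (suc n) f zero    _         = refl
  coeff-shift-< (suc n) f (suc i) (s≤s i<n) = coeff-shift-< n f i i<n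

  coeff-shift-+ : ∀ n f i → coeff (shift n f) (n ℕ.+ i) ≡ coeff f i
  coeff-shift-+ zero    f i = refl
  coeff-shift-+ (suc n) f i = coeff-shift-+ n f i

  ^-neg-even : ∀ t {e} → 2 ∣ e → (- t) ^ e ≡ t ^ e
  ^-neg-even t (divides zero    refl) = refl
  ^-neg-even t (divides (suc k) refl) =
    trans (cong (λ v → - t * (- t * v)) (^-neg-even t (divides k refl))) (square t _)
    where
    square : ∀ t x → - t * (- t * x) ≡ t * (t * x)
    square = solve-∀

  ^-neg-odd : ∀ t k → (- t) ^ suc (k ℕ.* 2) ≡ - t ^ suc (k ℕ.* 2)
  ^-neg-odd t k = trans (cong (- t *_) (^-neg-even t (divides k refl))) (sym (neg-distribˡ-* t _))

  [x-1]f≈[xⁿ-1]g : ∀ n f g → f ≈ₚ geometric n *ₚ g → shift 1 f -ₚ f ≈ₚ shift n g -ₚ g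
  [x-1]f≈[xⁿ-1]g n f g f≈geometric*g = ≈ₚ-fromEval (shift 1 f -ₚ f) (shift n g -ₚ g) (λ m → at (+ (2 ℕ.+ m)))
    where
    at : ∀ t → eval t (shift 1 f -ₚ f) ≡ eval t (shift n g -ₚ g)
    at t = begin
      eval t (shift 1 f -ₚ f)                     ≡⟨ eval-minusₚ t (shift 1 f) f ⟩
      eval t (shift 1 f) - eval t f               ≡⟨ cong (_- eval t f) (eval-shift t 1 f) ⟩
      t ^ 1 * eval t f - eval t f                 ≡⟨ factor t (eval t f) ⟩
      (t - 1ℤ) * eval t f
        ≡⟨ cong ((t - 1ℤ) *_) (eval-cong t f (geometric n *ₚ g) f≈geometric*g) ⟩
      (t - 1ℤ) * eval t (geometric n *ₚ g)        ≡⟨ cong ((t - 1ℤ) *_) (eval-*ₚ t (geometric n) g) ⟩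
      (t - 1ℤ) * (eval t (geometric n) * eval t g) ≡⟨ sym (*-assoc (t - 1ℤ) _ _) ⟩
      (t - 1ℤ) * eval t (geometric n) * eval t g  ≡⟨ cong (_* eval t g) (eval-geometric t n) ⟩
      (t ^ n - 1ℤ) * eval t g                     ≡⟨ expand (t ^ n) (eval t g) ⟩
      t ^ n * eval t g - eval t g                 ≡⟨ sym (cong (_- eval t g) (eval-shift t n g)) ⟩
      eval t (shift n g) - eval t g               ≡⟨ sym (eval-minusₚ t (shift n g) g) ⟩
      eval t (shift n g -ₚ g)                     ∎
      where
      factor : ∀ t x → t * 1ℤ * x - x ≡ (t - 1ℤ) * x
      factor = solve-∀
      expand : ∀ u x → (u - 1ℤ) * x ≡ u * x - x
      expand = solve-∀

module Cyclotomic (Φ : ℕ → Poly) (cyclotomic : IsCyclotomicFamily Φ) where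
  open Evaluation
  open SpecialPolynomials
  open Divisors using (divisors-prime; divisors-2*prime)
  open import Data.Nat as ℕ using (ℕ; zero; suc; s≤s; z≤n)
  import Data.Nat.Properties as ℕ
  open import Data.Nat.Divisibility using (_∣_; _∣0; ∣-refl; ∣m∣n⇒∣m+n)
  open import Data.Nat.Primality using (Prime; prime[2]; prime⇒irreducible; prime⇒nonTrivial)
  open import Data.Integer using (ℤ; +_; -_; _+_; _*_; _-_; _^_; 0ℤ; 1ℤ; ≢-nonZero)
  open import Data.Integer.Properties
    using (*-cancelˡ-≡; *-identityʳ; pos-*; +-injective; i-j≡0⇒i≡j; ^-distribˡ-+-*)
  open import Data.Integer.Tactic.RingSolver using (solve-∀)
  open import Data.List using ([]; _∷_; map; foldr)
  open import Data.Product using (Σ; _,_)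
  open import Data.Sum using (inj₂)
  open import Function using (_∘_)
  open import Relation.Nullary using (¬_; contradiction)
  open import Relation.Binary.PropositionalEquality
    using (_≡_; refl; cong; cong₂; sym; trans; module ≡-Reasoning)

  private
    cancel : ∀ {x y z} → x ≢ 0ℤ → x * y ≡ x * z → y ≡ z
    cancel {x} {y} {z} x≢0 = *-cancelˡ-≡ x y z {{≢-nonZero x≢0}}

    eval-prodₚ : ∀ t fs → eval t (prodₚ fs) ≡ foldr _*_ 1ℤ (map (eval t) fs)
    eval-prodₚ t []       = eval-oneₚ t
    eval-prodₚ t (f ∷ fs) = trans (eval-*ₚ t f (prodₚ fs)) (cong (eval t f *_) (eval-prodₚ t fs))

    pos-^ : ∀ m n → (+ m) ^ n ≡ + (m ℕ.^ n)
    pos-^ m zero    = refl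
    pos-^ m (suc n) = trans (cong (+ m *_) (pos-^ m n)) (sym (pos-* m (m ℕ.^ n)))

    [2+m]^n-1≢0 : ∀ m n → 1 ℕ.≤ n → (+ (2 ℕ.+ m)) ^ n - 1ℤ ≢ 0ℤ
    [2+m]^n-1≢0 m n n≥1 eq =
      ℕ.<⇒≢ 1<[2+m]^n (sym (+-injective (trans (sym (pos-^ (2 ℕ.+ m) n)) (i-j≡0⇒i≡j _ _ eq))))
      where
      1<[2+m]^n : 1 ℕ.< (2 ℕ.+ m) ℕ.^ n
      1<[2+m]^n = ℕ.^-monoʳ-< (2 ℕ.+ m) (s≤s (s≤s z≤n)) n≥1

    prime>2⇒odd : ∀ {p} → Prime p → 2 ℕ.< p → Σ ℕ λ k → p ≡ suc (k ℕ.* 2)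
    prime>2⇒odd {p} pp 2<p = odd-shape p 2∤p
      where
      2∤p : ¬ 2 ∣ p
      2∤p 2∣p with prime⇒irreducible pp 2∣p
      ... | inj₂ refl = ℕ.<-irrefl refl 2<p
      odd-shape : ∀ n → ¬ 2 ∣ n → Σ ℕ λ k → n ≡ suc (k ℕ.* 2)
      odd-shape zero          2∤0   = contradiction (2 ∣0) 2∤0
      odd-shape (suc zero)    _     = 0 , refl
      odd-shape (suc (suc n)) 2∤2+n with odd-shape n (2∤2+n ∘ ∣m∣n⇒∣m+n ∣-refl)
      ... | k , refl = suc k , refl

  x^n-1≡∏Φ : ∀ t n → 1 ℕ.≤ n → t ^ n - 1ℤ ≡ foldr _*_ 1ℤ (map (eval t) (map Φ (divisors n)))
  x^n-1≡∏Φ t n n≥1 = begin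
    t ^ n - 1ℤ                              ≡⟨ sym (cong₂ _-_ (eval-X^ t n) (eval-oneₚ t)) ⟩
    eval t (X^ n) - eval t oneₚ             ≡⟨ sym (eval-minusₚ t (X^ n) oneₚ) ⟩
    eval t (X^ n -ₚ oneₚ)
      ≡⟨ eval-cong t (X^ n -ₚ oneₚ) (prodₚ (map Φ (divisors n))) (cyclotomic n n≥1) ⟩
    eval t (prodₚ (map Φ (divisors n)))     ≡⟨ eval-prodₚ t (map Φ (divisors n)) ⟩
    foldr _*_ 1ℤ (map (eval t) (map Φ (divisors n))) ∎
    where open ≡-Reasoning

  eval-Φ-1 : ∀ t → eval t (Φ 1) ≡ t - 1ℤ
  eval-Φ-1 t = trans (sym (*-identityʳ _))
    (trans (sym (x^n-1≡∏Φ t 1 (s≤s z≤n))) (cong (_- 1ℤ) (*-identityʳ t)))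

  eval-Φ-prime : ∀ {p} → Prime p → ∀ t → (t - 1ℤ) * eval t (Φ p) ≡ t ^ p - 1ℤ
  eval-Φ-prime {p} pp t = sym (begin
    t ^ p - 1ℤ                                         ≡⟨ x^n-1≡∏Φ t p p≥1 ⟩
    foldr _*_ 1ℤ (map (eval t) (map Φ (divisors p)))
      ≡⟨ cong (foldr _*_ 1ℤ ∘ map (eval t) ∘ map Φ) (divisors-prime pp) ⟩
    eval t (Φ 1) * (eval t (Φ p) * 1ℤ)                 ≡⟨ cong₂ _*_ (eval-Φ-1 t) (*-identityʳ _) ⟩
    (t - 1ℤ) * eval t (Φ p)                            ∎)
    where
    open ≡-Reasoning
    p≥1 : 1 ℕ.≤ p
    p≥1 = ℕ.<⇒≤ (ℕ.nonTrivial⇒n>1 p {{prime⇒nonTrivial pp}})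

  Φ-prime≈geometric : ∀ {p} → Prime p → Φ p ≈ₚ geometric p
  Φ-prime≈geometric {p} pp = ≈ₚ-fromEval (Φ p) (geometric p) λ m →
    cancel {+ (2 ℕ.+ m) - 1ℤ} (λ ())
      (trans (eval-Φ-prime pp (+ (2 ℕ.+ m))) (sym (eval-geometric (+ (2 ℕ.+ m)) p)))

  eval-Φ-prime-1 : ∀ {p} → Prime p → eval 1ℤ (Φ p) ≡ + p
  eval-Φ-prime-1 {p} pp = trans (eval-cong 1ℤ (Φ p) (geometric p) (Φ-prime≈geometric pp)) (eval-geometric-1 p)

  eval-Φ-2 : ∀ t → eval t (Φ 2) ≡ t + 1ℤ
  eval-Φ-2 t = trans (eval-cong t (Φ 2) (geometric 2) (Φ-prime≈geometric prime[2])) (expand t)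
    where
    expand : ∀ t → 1ℤ + t * (1ℤ + t * 0ℤ) ≡ t + 1ℤ
    expand = solve-∀

  -- For s ≥ 2, dividing s^(2p) - 1 = Φ₁(s) Φ₂(s) Φₚ(s) Φ₂ₚ(s) by sᵖ - 1 = Φ₁(s) Φₚ(s) gives
  -- (s + 1) Φ₂ₚ(s) = sᵖ + 1, and as p is odd this is also (s + 1) (1 - s + s² - ⋯ + s^(p-1)).
  Φ-2*prime≈alt-geometric : ∀ {p} → Prime p → 2 ℕ.< p → Φ (2 ℕ.* p) ≈ₚ alt (geometric p)
  Φ-2*prime≈alt-geometric {p} pp 2<p = ≈ₚ-fromEval (Φ (2 ℕ.* p)) (alt (geometric p)) λ m →
    cancel {+ (2 ℕ.+ m) + 1ℤ} (λ ()) (trans ([s+1]*Φ₂ₚ m) (sym ([s+1]*alt-geometric m)))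
    where
    open ≡-Reasoning
    p≥1 : 1 ℕ.≤ p
    p≥1 = ℕ.<⇒≤ (ℕ.<-trans (s≤s (s≤s z≤n)) 2<p)

    ^p-neg : ∀ t → (- t) ^ p ≡ - t ^ p
    ^p-neg t with prime>2⇒odd pp 2<p
    ... | k , refl = ^-neg-odd t k

    [s+1]*alt-geometric : ∀ m → let s = + (2 ℕ.+ m) in (s + 1ℤ) * eval s (alt (geometric p)) ≡ s ^ p + 1ℤ
    [s+1]*alt-geometric m = begin
      (s + 1ℤ) * eval s (alt (geometric p))       ≡⟨ cong ((s + 1ℤ) *_) (eval-alt s (geometric p)) ⟩
      (s + 1ℤ) * eval (- s) (geometric p)         ≡⟨ flip-sign s _ ⟩
      - ((- s - 1ℤ) * eval (- s) (geometric p))   ≡⟨ cong -_ (eval-geometric (- s) p) ⟩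
      - ((- s) ^ p - 1ℤ)                          ≡⟨ cong (λ v → - (v - 1ℤ)) (^p-neg s) ⟩
      - (- s ^ p - 1ℤ)                            ≡⟨ flip-sign′ (s ^ p) ⟩
      s ^ p + 1ℤ                                  ∎
      where
      s : ℤ
      s = + (2 ℕ.+ m)
      flip-sign : ∀ s g → (s + 1ℤ) * g ≡ - ((- s - 1ℤ) * g)
      flip-sign = solve-∀
      flip-sign′ : ∀ u → - (- u - 1ℤ) ≡ u + 1ℤ
      flip-sign′ = solve-∀

    [s+1]*Φ₂ₚ : ∀ m → let s = + (2 ℕ.+ m) in (s + 1ℤ) * eval s (Φ (2 ℕ.* p)) ≡ s ^ p + 1ℤ
    [s+1]*Φ₂ₚ m = cancel ([2+m]^n-1≢0 m p p≥1) (begin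
      (s ^ p - 1ℤ) * ((s + 1ℤ) * φ₂ₚ)
        ≡⟨ cong (_* ((s + 1ℤ) * φ₂ₚ)) (sym (eval-Φ-prime pp s)) ⟩
      (s - 1ℤ) * φₚ * ((s + 1ℤ) * φ₂ₚ)
        ≡⟨ regroup (s - 1ℤ) (s + 1ℤ) φₚ φ₂ₚ ⟩
      (s - 1ℤ) * ((s + 1ℤ) * (φₚ * (φ₂ₚ * 1ℤ)))
        ≡⟨ cong₂ (λ u v → u * (v * (φₚ * (φ₂ₚ * 1ℤ)))) (sym (eval-Φ-1 s)) (sym (eval-Φ-2 s)) ⟩
      eval s (Φ 1) * (eval s (Φ 2) * (φₚ * (φ₂ₚ * 1ℤ)))
        ≡⟨ cong (foldr _*_ 1ℤ ∘ map (eval s) ∘ map Φ) (sym (divisors-2*prime pp 2<p)) ⟩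
      foldr _*_ 1ℤ (map (eval s) (map Φ (divisors (2 ℕ.* p))))
        ≡⟨ sym (x^n-1≡∏Φ s (2 ℕ.* p) 2p≥1) ⟩
      s ^ (2 ℕ.* p) - 1ℤ                                ≡⟨ cong (λ e → s ^ (p ℕ.+ e) - 1ℤ) (ℕ.+-identityʳ p) ⟩
      s ^ (p ℕ.+ p) - 1ℤ                                ≡⟨ cong (_- 1ℤ) (^-distribˡ-+-* s p p) ⟩
      s ^ p * s ^ p - 1ℤ                                ≡⟨ difference-of-squares (s ^ p) ⟩
      (s ^ p - 1ℤ) * (s ^ p + 1ℤ)                       ∎)
      where
      s φₚ φ₂ₚ : ℤ
      s = + (2 ℕ.+ m)
      φₚ = eval s (Φ p)
      φ₂ₚ = eval s (Φ (2 ℕ.* p))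
      2p≥1 : 1 ℕ.≤ 2 ℕ.* p
      2p≥1 = ℕ.≤-trans p≥1 (ℕ.m≤m+n p (p ℕ.+ 0))
      regroup : ∀ a b x y → a * x * (b * y) ≡ a * (b * (x * (y * 1ℤ)))
      regroup = solve-∀
      difference-of-squares : ∀ u → u * u - 1ℤ ≡ (u - 1ℤ) * (u + 1ℤ)
      difference-of-squares = solve-∀

module SignedMonomialSums where
  open import Data.Nat as ℕ using ()
  open import Data.Integer using (ℤ; _+_; _-_)
  open import Data.List using (List; []; _∷_; foldl)
  open import Data.List.Relation.Unary.All using (All; []; _∷_)
  open import Data.Product using (_×_; _,_; proj₂)
  open import Data.Sign.Base as Sign using (Sign)
  open import Relation.Binary.PropositionalEquality using (_≡_; refl; cong; cong₂; trans)

  addMonomial : Poly → Sign × ℕ → Poly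
  addMonomial f (Sign.+ , e) = f +ₚ X^ e
  addMonomial f (Sign.- , e) = f -ₚ X^ e

  monomialSum : ℕ → List (Sign × ℕ) → Poly
  monomialSum e₀ = foldl addMonomial (X^ e₀)

  addValue : (ℕ → ℤ) → ℤ → Sign × ℕ → ℤ
  addValue h x (Sign.+ , e) = x + h e
  addValue h x (Sign.- , e) = x - h e

  signedSum : (ℕ → ℤ) → ℕ → List (Sign × ℕ) → ℤ
  signedSum h e₀ = foldl (addValue h) (h e₀)

  -- R a b and Q a b are, by definition, monomialSum (2a + 2b) applied to these lists, so a functional
  -- that is additive on them is determined by its values on monomials.
  R-monomials : ℕ → ℕ → List (Sign × ℕ)
  R-monomials a b = (Sign.+ , 2 ℕ.* a) ∷ (Sign.+ , 2 ℕ.* b) ∷ (Sign.+ , 0)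
    ∷ (Sign.+ , 2 ℕ.* a ℕ.+ b) ∷ (Sign.+ , a ℕ.+ 2 ℕ.* b) ∷ (Sign.+ , a) ∷ (Sign.+ , b) ∷ []

  Q-monomials : ℕ → ℕ → List (Sign × ℕ)
  Q-monomials a b = (Sign.+ , 2 ℕ.* a) ∷ (Sign.+ , 2 ℕ.* b) ∷ (Sign.+ , 0)
    ∷ (Sign.- , 2 ℕ.* a ℕ.+ b) ∷ (Sign.- , a ℕ.+ 2 ℕ.* b) ∷ (Sign.- , a) ∷ (Sign.- , b) ∷ []

  record Additive (L : Poly → ℤ) : Set where
    field
      +ₚ-homo : ∀ f g → L (f +ₚ g) ≡ L f + L g
      -ₚ-homo : ∀ f g → L (f -ₚ g) ≡ L f - L g

  additive-monomialSum : ∀ {L} → Additive L → ∀ e₀ ts →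
                         L (monomialSum e₀ ts) ≡ signedSum (λ e → L (X^ e)) e₀ ts
  additive-monomialSum {L} additive e₀ ts = go (X^ e₀) ts
    where
    open Additive additive
    go : ∀ f ts → L (foldl addMonomial f ts) ≡ foldl (addValue (λ e → L (X^ e))) (L f) ts
    go f []                   = refl
    go f ((Sign.+ , e) ∷ ts) =
      trans (go (f +ₚ X^ e) ts) (cong (λ x → foldl (addValue _) x ts) (+ₚ-homo f (X^ e)))
    go f ((Sign.- , e) ∷ ts) =
      trans (go (f -ₚ X^ e) ts) (cong (λ x → foldl (addValue _) x ts) (-ₚ-homo f (X^ e)))

  signedSum-cong : ∀ h h′ e₀ ts → h e₀ ≡ h′ e₀ → All (λ t → h (proj₂ t) ≡ h′ (proj₂ t)) ts →
                   signedSum h e₀ ts ≡ signedSum h′ e₀ ts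
  signedSum-cong h h′ e₀ ts h≡h′ = go h≡h′
    where
    go : ∀ {x x′ ts} → x ≡ x′ → All (λ t → h (proj₂ t) ≡ h′ (proj₂ t)) ts →
         foldl (addValue h) x ts ≡ foldl (addValue h′) x′ ts
    go x≡x′ []                        = x≡x′
    go x≡x′ (_∷_ {Sign.+ , e} he hs) = go (cong₂ _+_ x≡x′ he) hs
    go x≡x′ (_∷_ {Sign.- , e} he hs) = go (cong₂ _-_ x≡x′ he) hs

module ResidueClassSums (p : ℕ) {{_ : NonZero p}} where
  open Coefficients
  open SpecialPolynomials using (shift; coeff-shift-<; coeff-shift-+)
  open SignedMonomialSums using (Additive)
  open import Data.Nat as ℕ using (ℕ; zero; suc; _≤_; _<_; z≤n; s≤s; _≟_)
  import Data.Nat.Properties as ℕ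
  open import Data.Nat.DivMod using (_%_; _/_; m≡m%n+[m/n]*n; [m+kn]%n≡m%n; m<n⇒m%n≡m; m/n≤m)
  open import Data.Integer using (ℤ; +_; -_; _+_; _-_; 0ℤ; 1ℤ)
  open import Data.Integer.Properties using (+-identityˡ; +-identityʳ; i-j≡0⇒i≡j)
  open import Data.Integer.Tactic.RingSolver using (solve-∀)
  open import Data.List using (length)
  open import Function using (_∘_)
  open import Relation.Nullary using (yes; no)
  open import Relation.Binary.PropositionalEquality
    using (_≡_; _≢_; refl; cong; cong₂; sym; trans; subst; module ≡-Reasoning)

  sumTo : (ℕ → ℤ) → ℕ → ℤ
  sumTo h zero    = h zero
  sumTo h (suc K) = sumTo h K + h (suc K)

  sumTo-cong : ∀ {h h′} → (∀ k → h k ≡ h′ k) → ∀ K → sumTo h K ≡ sumTo h′ K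
  sumTo-cong h≡h′ zero    = h≡h′ zero
  sumTo-cong h≡h′ (suc K) = cong₂ _+_ (sumTo-cong h≡h′ K) (h≡h′ (suc K))

  sumTo-+ : ∀ h h′ K → sumTo (λ k → h k + h′ k) K ≡ sumTo h K + sumTo h′ K
  sumTo-+ h h′ zero    = refl
  sumTo-+ h h′ (suc K) =
    trans (cong (_+ (h (suc K) + h′ (suc K))) (sumTo-+ h h′ K)) (interchange (sumTo h K) (sumTo h′ K) _ _)
    where
    interchange : ∀ a b c d → a + b + (c + d) ≡ a + c + (b + d)
    interchange = solve-∀

  sumTo-minus : ∀ h h′ K → sumTo (λ k → h k - h′ k) K ≡ sumTo h K - sumTo h′ K
  sumTo-minus h h′ zero    = refl
  sumTo-minus h h′ (suc K) =
    trans (cong (_+ (h (suc K) - h′ (suc K))) (sumTo-minus h h′ K)) (interchange (sumTo h K) (sumTo h′ K) _ _)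
    where
    interchange : ∀ a b c d → a - b + (c - d) ≡ a + c - (b + d)
    interchange = solve-∀

  sumTo-zero : ∀ {h} K → (∀ k → k ≤ K → h k ≡ 0ℤ) → sumTo h K ≡ 0ℤ
  sumTo-zero zero    h≡0 = h≡0 0 z≤n
  sumTo-zero (suc K) h≡0 =
    cong₂ _+_ (sumTo-zero K (λ k k≤K → h≡0 k (ℕ.m≤n⇒m≤1+n k≤K))) (h≡0 (suc K) ℕ.≤-refl)

  sumTo-single : ∀ {h k₀} K → (∀ k → k ≢ k₀ → h k ≡ 0ℤ) → k₀ ≤ K → sumTo h K ≡ h k₀
  sumTo-single zero    _      z≤n = refl
  sumTo-single {h} {k₀} (suc K) others k₀≤1+K with k₀ ≟ suc K
  ... | yes refl = trans (cong (_+ h (suc K)) (sumTo-zero K (λ k k≤K → others k (ℕ.<⇒≢ (s≤s k≤K)))))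
                         (+-identityˡ _)
  ... | no  k₀≢  = trans (cong₂ _+_ (sumTo-single K others (ℕ.≤-pred (ℕ.≤∧≢⇒< k₀≤1+K k₀≢)))
                                    (others (suc K) (k₀≢ ∘ sym)))
                         (+-identityʳ _)

  classSum : ℕ → ℕ → Poly → ℤ
  classSum K j f = sumTo (λ k → coeff f (j ℕ.+ k ℕ.* p)) K

  classSum-additive : ∀ K j → Additive (classSum K j)
  classSum-additive K j = record
    { +ₚ-homo = λ f g → trans (sumTo-cong (λ k → coeff-+ₚ f g (j ℕ.+ k ℕ.* p)) K) (sumTo-+ _ _ K)
    ; -ₚ-homo = λ f g → trans (sumTo-cong (λ k → coeff-minusₚ f g (j ℕ.+ k ℕ.* p)) K) (sumTo-minus _ _ K)
    }

  classSum-X^-≡ : ∀ K j e → j < p → e % p ≡ j → e ≤ K → classSum K j (X^ e) ≡ 1ℤ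
  classSum-X^-≡ K j e j<p e%p≡j e≤K = trans (sumTo-single K others (ℕ.≤-trans (m/n≤m e p) e≤K))
                                            (trans (cong (coeff (X^ e)) (sym e≡j+[e/p]p)) (coeff-X^-≡ e))
    where
    e≡j+[e/p]p : e ≡ j ℕ.+ e / p ℕ.* p
    e≡j+[e/p]p = trans (m≡m%n+[m/n]*n e p) (cong (ℕ._+ e / p ℕ.* p) e%p≡j)
    others : ∀ k → k ≢ e / p → coeff (X^ e) (j ℕ.+ k ℕ.* p) ≡ 0ℤ
    others k k≢ = coeff-X^-≢ e _ λ e≡ → k≢ (ℕ.*-cancelʳ-≡ k (e / p) p
      (ℕ.+-cancelˡ-≡ j _ _ (trans (sym e≡) e≡j+[e/p]p)))

  classSum-X^-≢ : ∀ K j e → j < p → e % p ≢ j → classSum K j (X^ e) ≡ 0ℤ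
  classSum-X^-≢ K j e j<p e%p≢j = sumTo-zero K λ k _ → coeff-X^-≢ e _ λ e≡ →
    e%p≢j (trans (cong (_% p) e≡) (trans ([m+kn]%n≡m%n j k p) (m<n⇒m%n≡m j<p)))

  classSum-shift-p : ∀ g K j → j < p → classSum K j (shift p g -ₚ g) ≡ - coeff g (j ℕ.+ K ℕ.* p)
  classSum-shift-p g zero j j<p = begin
    coeff (shift p g -ₚ g) (j ℕ.+ 0)              ≡⟨ coeff-minusₚ (shift p g) g _ ⟩
    coeff (shift p g) (j ℕ.+ 0) - coeff g (j ℕ.+ 0)
      ≡⟨ cong (_- _) (coeff-shift-< p g _ (subst (_< p) (sym (ℕ.+-identityʳ j)) j<p)) ⟩
    0ℤ - coeff g (j ℕ.+ 0)                        ≡⟨ +-identityˡ _ ⟩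
    - coeff g (j ℕ.+ 0) ∎
    where open ≡-Reasoning
  classSum-shift-p g (suc K) j j<p = begin
    classSum K j (shift p g -ₚ g) + coeff (shift p g -ₚ g) (j ℕ.+ suc K ℕ.* p)
      ≡⟨ cong₂ _+_ (classSum-shift-p g K j j<p) (coeff-minusₚ (shift p g) g _) ⟩
    - coeff g (j ℕ.+ K ℕ.* p) + (coeff (shift p g) (j ℕ.+ suc K ℕ.* p) - coeff g (j ℕ.+ suc K ℕ.* p))
      ≡⟨ cong (λ c → - coeff g (j ℕ.+ K ℕ.* p) + (c - coeff g (j ℕ.+ suc K ℕ.* p))) previous ⟩
    - coeff g (j ℕ.+ K ℕ.* p) + (coeff g (j ℕ.+ K ℕ.* p) - coeff g (j ℕ.+ suc K ℕ.* p))
      ≡⟨ cancel (coeff g (j ℕ.+ K ℕ.* p)) _ ⟩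
    - coeff g (j ℕ.+ suc K ℕ.* p) ∎
    where
    open ≡-Reasoning
    swap : ∀ a b c → a ℕ.+ (b ℕ.+ c) ≡ b ℕ.+ (a ℕ.+ c)
    swap a b c = trans (sym (ℕ.+-assoc a b c)) (trans (cong (ℕ._+ c) (ℕ.+-comm a b)) (ℕ.+-assoc b a c))
    previous : coeff (shift p g) (j ℕ.+ suc K ℕ.* p) ≡ coeff g (j ℕ.+ K ℕ.* p)
    previous = trans (cong (coeff (shift p g)) (swap j p (K ℕ.* p))) (coeff-shift-+ p g _)
    cancel : ∀ x y → - x + (x - y) ≡ - y
    cancel = solve-∀

  -- From (x - 1) f = (x^p - 1) g: the class of j + 1 in x f - f gives classSum j f - classSum (j + 1) f,
  -- while in x^p g - g it telescopes to a coefficient of g beyond its length.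
  classSum-constant : ∀ f g K → shift 1 f -ₚ f ≈ₚ shift p g -ₚ g → length g ≤ K →
                      ∀ j → j < p → classSum K j f ≡ classSum K 0 f
  classSum-constant f g K identity lg≤K zero    _     = refl
  classSum-constant f g K identity lg≤K (suc j) 1+j<p =
    trans (sym step) (classSum-constant f g K identity lg≤K j (ℕ.<⇒≤ 1+j<p))
    where
    open ≡-Reasoning
    lg≤index : length g ≤ suc j ℕ.+ K ℕ.* p
    lg≤index = ℕ.≤-trans lg≤K (ℕ.≤-trans (ℕ.m≤m*n K p) (ℕ.m≤n+m _ (suc j)))
    step : classSum K j f ≡ classSum K (suc j) f
    step = i-j≡0⇒i≡j _ _ (begin
      classSum K j f - classSum K (suc j) f
        ≡⟨ sym (Additive.-ₚ-homo (classSum-additive K (suc j)) (shift 1 f) f) ⟩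
      classSum K (suc j) (shift 1 f -ₚ f)   ≡⟨ sumTo-cong (λ k → identity (suc j ℕ.+ k ℕ.* p)) K ⟩
      classSum K (suc j) (shift p g -ₚ g)   ≡⟨ classSum-shift-p g K (suc j) 1+j<p ⟩
      - coeff g (suc j ℕ.+ K ℕ.* p)         ≡⟨ cong -_ (coeff-≥length g _ lg≤index) ⟩
      0ℤ                                    ∎)

module ResidueIndicator (p : ℕ) {{_ : NonZero p}} where
  open import Data.Nat as ℕ using (suc; _≤_; z≤n; s≤s; _≟_)
  import Data.Nat.Divisibility as ℕ
  open import Data.Nat.DivMod using (_%_; m<n⇒m%n≡m)
  open import Data.Integer using (ℤ; +_; -[1+_]; _+_; _*_; _-_; 0ℤ; _%ℕ_; _/ℕ_)
  open import Data.Integer.Properties using (+-identityʳ)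
  open import Data.Integer.DivMod using (a≡a%ℕn+[a/ℕn]*n)
  open import Data.Integer.Divisibility.Signed using (_∣_; divides; ∣⇒∣ᵤ)
  open import Data.Integer.Tactic.RingSolver using (solve-∀)
  open import Function using (_∘_)
  open import Relation.Nullary using (¬_; yes; no; contradiction)
  open import Relation.Binary.PropositionalEquality
    using (_≡_; refl; cong; cong₂; sym; trans; subst; module ≡-Reasoning)

  δ : ℕ → ℤ → ℕ
  δ j E with E %ℕ p ≟ j
  ... | yes _ = 1
  ... | no  _ = 0

  δ-≡ : ∀ {j E} → E %ℕ p ≡ j → δ j E ≡ 1
  δ-≡ {j} {E} E≡j with E %ℕ p ≟ j
  ... | yes _   = refl
  ... | no  E≢j = contradiction E≡j E≢j

  δ-≢ : ∀ {j E} → E %ℕ p ≢ j → δ j E ≡ 0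
  δ-≢ {j} {E} E≢j with E %ℕ p ≟ j
  ... | yes E≡j = contradiction E≡j E≢j
  ... | no  _   = refl

  δ≤1 : ∀ j E → δ j E ≤ 1
  δ≤1 j E with E %ℕ p ≟ j
  ... | yes _ = s≤s z≤n
  ... | no  _ = z≤n

  %ℕ≡⇒∣- : ∀ E U → E %ℕ p ≡ U %ℕ p → + p ∣ E - U
  %ℕ≡⇒∣- E U E≡U = divides (E /ℕ p - U /ℕ p) (begin
    E - U                                  ≡⟨ cong₂ _-_ (a≡a%ℕn+[a/ℕn]*n E p) (a≡a%ℕn+[a/ℕn]*n U p) ⟩
    (+ (E %ℕ p) + E /ℕ p * + p) - U′       ≡⟨ cong (λ r → (+ r + E /ℕ p * + p) - U′) E≡U ⟩
    (+ (U %ℕ p) + E /ℕ p * + p) - U′       ≡⟨ cancel (+ (U %ℕ p)) (E /ℕ p) (U /ℕ p) (+ p) ⟩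
    (E /ℕ p - U /ℕ p) * + p                ∎)
    where
    open ≡-Reasoning
    U′ : ℤ
    U′ = + (U %ℕ p) + U /ℕ p * + p
    cancel : ∀ r x y q → (r + x * q) - (r + y * q) ≡ (x - y) * q
    cancel = solve-∀

  ∣⇒%ℕ≡0 : ∀ {E} → + p ∣ E → E %ℕ p ≡ 0
  ∣⇒%ℕ≡0 {+ n}      p∣E = ℕ.n∣m⇒m%n≡0 n p (∣⇒∣ᵤ p∣E)
  ∣⇒%ℕ≡0 { -[1+ n ]} p∣E with suc n % p | ℕ.n∣m⇒m%n≡0 (suc n) p (∣⇒∣ᵤ p∣E)
  ... | .0 | refl = refl

  δ-refl : ∀ U → δ (U %ℕ p) U ≡ 1
  δ-refl U = δ-≡ refl

  δ-∤ : ∀ U E → ¬ + p ∣ E - U → δ (U %ℕ p) E ≡ 0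
  δ-∤ U E p∤E-U = δ-≢ (p∤E-U ∘ %ℕ≡⇒∣- E U)

  δ₀-∣ : ∀ {E} → + p ∣ E → δ 0 E ≡ 1
  δ₀-∣ p∣E = δ-≡ (∣⇒%ℕ≡0 p∣E)

  δ₀-∤ : ∀ E → ¬ + p ∣ E → δ 0 E ≡ 0
  δ₀-∤ E p∤E = δ-≢ λ E%p≡0 →
    p∤E (subst (+ p ∣_) (+-identityʳ E) (%ℕ≡⇒∣- E 0ℤ (trans E%p≡0 (sym 0%p≡0))))
    where
    0%p≡0 : 0 % p ≡ 0
    0%p≡0 = m<n⇒m%n≡m (ℕ.>-nonZero⁻¹ p)

module ResidueCounting {p : ℕ} (pp : Prime p) (2<p : 2 < p) (p≢5 : p ≢ 5) where
  open import Data.Nat as ℕ using (z≤n; s≤s; _≤_; _≟_)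
  import Data.Nat.Properties as ℕ
  import Data.Nat.Divisibility as ℕ
  open import Data.Nat.DivMod using (_%_)
  open import Data.Nat.Primality using (prime⇒nonZero; prime⇒irreducible; euclidsLemma; prime?)
  open import Data.Integer using (ℤ; +_; -_; _+_; _*_; _-_; 0ℤ; 1ℤ; -1ℤ; ∣_∣; _%ℕ_)
  open import Data.Integer.Properties using (pos-+; pos-*; +-comm; +-injective; abs-*)
  open import Data.Integer.DivMod using (n%ℕd<d)
  open import Data.Integer.Divisibility.Signed
    using (_∣_; _∣?_; divides; ∣ᵤ⇒∣; ∣⇒∣ᵤ; ∣n⇒∣m*n; ∣m∣n⇒∣m+n)
  open import Data.Integer.Tactic.RingSolver using (solve-∀; solve)
  open import Data.List using ([]; _∷_)
  open import Data.List.Relation.Unary.All using (All) renaming (map to All-map)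
  open import Data.Product using (_×_; _,_; proj₂)
  open import Data.Sum using (inj₁; inj₂)
  open import Function using (_∘_)
  open import Relation.Nullary using (¬_; yes; no; contradiction)
  open import Relation.Nullary.Decidable using (from-yes)
  open import Relation.Binary.PropositionalEquality
    using (_≡_; refl; cong; cong₂; sym; trans; subst; module ≡-Reasoning)
  open SignedMonomialSums

  private instance
    p≢0 : ℕ.NonZero p
    p≢0 = prime⇒nonZero pp

  open ResidueClassSums p
  open ResidueIndicator p

  -- For A = + a and B = + b: the number of monomials of Q a b with sign + (resp. -) whose exponent
  -- lies in the residue class j mod p.
  positives : ℕ → ℤ → ℤ → ℕ
  positives j A B = δ j (+ 2 * A + + 2 * B) ℕ.+ δ j (+ 2 * A) ℕ.+ δ j (+ 2 * B) ℕ.+ δ j 0ℤ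

  negatives : ℕ → ℤ → ℤ → ℕ
  negatives j A B = δ j (+ 2 * A + B) ℕ.+ δ j (A + + 2 * B) ℕ.+ δ j A ℕ.+ δ j B

  private
    δ₄-cong : ∀ {j E₁ E₂ E₃ E₄ F₁ F₂ F₃ F₄} →
              E₁ ≡ F₁ → E₂ ≡ F₂ → E₃ ≡ F₃ → E₄ ≡ F₄ →
              δ j E₁ ℕ.+ δ j E₂ ℕ.+ δ j E₃ ℕ.+ δ j E₄ ≡ δ j F₁ ℕ.+ δ j F₂ ℕ.+ δ j F₃ ℕ.+ δ j F₄
    δ₄-cong refl refl refl refl = refl

  classSum-X^ : ∀ K j e → j ℕ.< p → e ≤ K → classSum K j (X^ e) ≡ + δ j (+ e)
  classSum-X^ K j e j<p e≤K with e % p ≟ j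
  ... | yes e≡j = classSum-X^-≡ K j e j<p e≡j e≤K
  ... | no  e≢j = classSum-X^-≢ K j e j<p e≢j

  classSum-Q : ∀ K j a b → j ℕ.< p → 2 ℕ.* a ℕ.+ 2 ℕ.* b ≤ K →
               classSum K j (Q a b) ≡ + positives j (+ a) (+ b) - + negatives j (+ a) (+ b)
  classSum-Q K j a b j<p deg≤K = begin
    classSum K j (Q a b)
      ≡⟨ additive-monomialSum (classSum-additive K j) (2 ℕ.* a ℕ.+ 2 ℕ.* b) (Q-monomials a b) ⟩
    signedSum (classSum K j ∘ X^) (2 ℕ.* a ℕ.+ 2 ℕ.* b) (Q-monomials a b)
      ≡⟨ signedSum-cong (classSum K j ∘ X^) (λ e → + δ j (+ e)) (2 ℕ.* a ℕ.+ 2 ℕ.* b) (Q-monomials a b)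
           (classSum-X^ K j _ j<p deg≤K)
           (All-map (λ e≤ → classSum-X^ K j _ j<p (ℕ.≤-trans e≤ deg≤K)) degrees) ⟩
    signedSum (λ e → + δ j (+ e)) (2 ℕ.* a ℕ.+ 2 ℕ.* b) (Q-monomials a b)
      ≡⟨ regroup (δ j (+ (2 ℕ.* a ℕ.+ 2 ℕ.* b))) (δ j (+ (2 ℕ.* a))) (δ j (+ (2 ℕ.* b))) (δ j 0ℤ)
                 (δ j (+ (2 ℕ.* a ℕ.+ b))) (δ j (+ (a ℕ.+ 2 ℕ.* b))) (δ j (+ a)) (δ j (+ b)) ⟩
    + (δ j (+ (2 ℕ.* a ℕ.+ 2 ℕ.* b)) ℕ.+ δ j (+ (2 ℕ.* a)) ℕ.+ δ j (+ (2 ℕ.* b)) ℕ.+ δ j 0ℤ)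
      - + (δ j (+ (2 ℕ.* a ℕ.+ b)) ℕ.+ δ j (+ (a ℕ.+ 2 ℕ.* b)) ℕ.+ δ j (+ a) ℕ.+ δ j (+ b))
      ≡⟨ cong₂ (λ P N → + P - + N) positives-cast negatives-cast ⟩
    + positives j (+ a) (+ b) - + negatives j (+ a) (+ b) ∎
    where
    open ≡-Reasoning
    open import Data.List.Relation.Unary.All using ([]; _∷_)
    a≤2a : a ≤ 2 ℕ.* a
    a≤2a = ℕ.m≤m+n a (a ℕ.+ 0)
    b≤2b : b ≤ 2 ℕ.* b
    b≤2b = ℕ.m≤m+n b (b ℕ.+ 0)
    degrees : All (λ t → proj₂ t ≤ 2 ℕ.* a ℕ.+ 2 ℕ.* b) (Q-monomials a b)
    degrees = ℕ.m≤m+n (2 ℕ.* a) (2 ℕ.* b) ∷ ℕ.m≤n+m (2 ℕ.* b) (2 ℕ.* a) ∷ z≤n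
            ∷ ℕ.+-monoʳ-≤ (2 ℕ.* a) b≤2b ∷ ℕ.+-monoˡ-≤ (2 ℕ.* b) a≤2a
            ∷ ℕ.≤-trans a≤2a (ℕ.m≤m+n (2 ℕ.* a) (2 ℕ.* b))
            ∷ ℕ.≤-trans b≤2b (ℕ.m≤n+m (2 ℕ.* b) (2 ℕ.* a)) ∷ []
    ⟨2a⟩ : + (2 ℕ.* a) ≡ + 2 * + a
    ⟨2a⟩ = pos-* 2 a
    ⟨2b⟩ : + (2 ℕ.* b) ≡ + 2 * + b
    ⟨2b⟩ = pos-* 2 b
    ⟨2a+2b⟩ : + (2 ℕ.* a ℕ.+ 2 ℕ.* b) ≡ + 2 * + a + + 2 * + b
    ⟨2a+2b⟩ = trans (pos-+ (2 ℕ.* a) _) (cong₂ _+_ ⟨2a⟩ ⟨2b⟩)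
    ⟨2a+b⟩ : + (2 ℕ.* a ℕ.+ b) ≡ + 2 * + a + + b
    ⟨2a+b⟩ = trans (pos-+ (2 ℕ.* a) b) (cong (_+ + b) ⟨2a⟩)
    ⟨a+2b⟩ : + (a ℕ.+ 2 ℕ.* b) ≡ + a + + 2 * + b
    ⟨a+2b⟩ = trans (pos-+ a (2 ℕ.* b)) (cong (_+_ (+ a)) ⟨2b⟩)
    positives-cast : δ j (+ (2 ℕ.* a ℕ.+ 2 ℕ.* b)) ℕ.+ δ j (+ (2 ℕ.* a)) ℕ.+ δ j (+ (2 ℕ.* b)) ℕ.+ δ j 0ℤ
                   ≡ positives j (+ a) (+ b)
    positives-cast = δ₄-cong ⟨2a+2b⟩ ⟨2a⟩ ⟨2b⟩ refl
    negatives-cast : δ j (+ (2 ℕ.* a ℕ.+ b)) ℕ.+ δ j (+ (a ℕ.+ 2 ℕ.* b)) ℕ.+ δ j (+ a) ℕ.+ δ j (+ b)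
                   ≡ negatives j (+ a) (+ b)
    negatives-cast = δ₄-cong ⟨2a+b⟩ ⟨a+2b⟩ refl refl
    regroup : ∀ i₁ i₂ i₃ i₄ i₅ i₆ i₇ i₈ →
      + i₁ + + i₂ + + i₃ + + i₄ - + i₅ - + i₆ - + i₇ - + i₈ ≡
      + (i₁ ℕ.+ i₂ ℕ.+ i₃ ℕ.+ i₄) - + (i₅ ℕ.+ i₆ ℕ.+ i₇ ℕ.+ i₈)
    regroup i₁ i₂ i₃ i₄ i₅ i₆ i₇ i₈ =
      trans (ring (+ i₁) (+ i₂) (+ i₃) (+ i₄) (+ i₅) (+ i₆) (+ i₇) (+ i₈))
            (sym (cong₂ _-_ (pos-+₄ i₁ i₂ i₃ i₄) (pos-+₄ i₅ i₆ i₇ i₈)))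
      where
      ring : ∀ a b c d e f g h → a + b + c + d - e - f - g - h ≡ (a + b + c + d) - (e + f + g + h)
      ring = solve-∀
      pos-+₄ : ∀ a b c d → + (a ℕ.+ b ℕ.+ c ℕ.+ d) ≡ + a + + b + + c + + d
      pos-+₄ a b c d = trans (pos-+ (a ℕ.+ b ℕ.+ c) d)
        (cong (_+ + d) (trans (pos-+ (a ℕ.+ b) c) (cong (_+ + c) (pos-+ a b))))

  -- The class sums of j and of 0 agree, cross-multiplied so as to stay in ℕ.
  Balanced : ℤ → ℤ → Set
  Balanced A B = ∀ j → j ℕ.< p → positives j A B ℕ.+ negatives 0 A B ≡ positives 0 A B ℕ.+ negatives j A B

  classSum-constant⇒balanced : ∀ K a b → 2 ℕ.* a ℕ.+ 2 ℕ.* b ≤ K →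
    (∀ j → j ℕ.< p → classSum K j (Q a b) ≡ classSum K 0 (Q a b)) → Balanced (+ a) (+ b)
  classSum-constant⇒balanced K a b deg≤K constant j j<p =
    cross-multiply (positives j A B) (negatives j A B) (positives 0 A B) (negatives 0 A B) (begin
    + positives j A B - + negatives j A B   ≡⟨ sym (classSum-Q K j a b j<p deg≤K) ⟩
    classSum K j (Q a b)                    ≡⟨ constant j j<p ⟩
    classSum K 0 (Q a b)                    ≡⟨ classSum-Q K 0 a b (ℕ.>-nonZero⁻¹ p) deg≤K ⟩
    + positives 0 A B - + negatives 0 A B   ∎)
    where
    open ≡-Reasoning
    A B : ℤ
    A = + a
    B = + b
    cross-multiply : ∀ m n k l → + m - + n ≡ + k - + l → m ℕ.+ l ≡ k ℕ.+ n
    cross-multiply m n k l eq = +-injective (begin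
      + (m ℕ.+ l)               ≡⟨ pos-+ m l ⟩
      + m + + l                 ≡⟨ add-back (+ m) (+ n) (+ l) ⟩
      (+ m - + n) + + n + + l   ≡⟨ cong (λ x → x + + n + + l) eq ⟩
      (+ k - + l) + + n + + l   ≡⟨ cancel (+ k) (+ l) (+ n) ⟩
      + k + + n                 ≡⟨ sym (pos-+ k n) ⟩
      + (k ℕ.+ n)               ∎)
      where
      add-back : ∀ x y z → x + z ≡ x - y + y + z
      add-back = solve-∀
      cancel : ∀ x y z → x - y + z + y ≡ x + z
      cancel = solve-∀

  balanced-sym : ∀ {A B} → Balanced A B → Balanced B A
  balanced-sym {A} {B} balanced j j<p = begin
    positives j B A ℕ.+ negatives 0 B A   ≡⟨ cong₂ ℕ._+_ (positives-sym j) (negatives-sym 0) ⟩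
    positives j A B ℕ.+ negatives 0 A B   ≡⟨ balanced j j<p ⟩
    positives 0 A B ℕ.+ negatives j A B   ≡⟨ sym (cong₂ ℕ._+_ (positives-sym 0) (negatives-sym j)) ⟩
    positives 0 B A ℕ.+ negatives j B A   ∎
    where
    open ≡-Reasoning
    open import Data.Nat.Tactic.RingSolver using () renaming (solve-∀ to ℕ-solve-∀)
    swap₂₃ : ∀ w x y z → w ℕ.+ x ℕ.+ y ℕ.+ z ≡ w ℕ.+ y ℕ.+ x ℕ.+ z
    swap₂₃ = ℕ-solve-∀
    swap-pairs : ∀ w x y z → w ℕ.+ x ℕ.+ y ℕ.+ z ≡ x ℕ.+ w ℕ.+ z ℕ.+ y
    swap-pairs = ℕ-solve-∀
    positives-sym : ∀ j → positives j B A ≡ positives j A B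
    positives-sym j = trans (δ₄-cong (+-comm (+ 2 * B) (+ 2 * A)) refl refl refl)
      (swap₂₃ (δ j (+ 2 * A + + 2 * B)) (δ j (+ 2 * B)) (δ j (+ 2 * A)) (δ j 0ℤ))
    negatives-sym : ∀ j → negatives j B A ≡ negatives j A B
    negatives-sym j = trans (δ₄-cong (+-comm (+ 2 * B) A) (+-comm B (+ 2 * A)) refl refl)
      (swap-pairs (δ j (A + + 2 * B)) (δ j (+ 2 * A + B)) (δ j B) (δ j A))

  private
    ∣-scale : ∀ α {S Z} → + p ∣ S → α * S ≡ Z → + p ∣ Z
    ∣-scale α p∣S eq = subst (+ p ∣_) eq (∣n⇒∣m*n α p∣S)

    ∣-combination : ∀ α β {S T Z} → + p ∣ S → + p ∣ T → α * S + β * T ≡ Z → + p ∣ Z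
    ∣-combination α β p∣S p∣T eq = subst (+ p ∣_) eq (∣m∣n⇒∣m+n (∣n⇒∣m*n α p∣S) (∣n⇒∣m*n β p∣T))

    ∣-cancel : ∀ c {Z} → ¬ p ℕ.∣ c → + p ∣ + c * Z → + p ∣ Z
    ∣-cancel c {Z} p∤c p∣cZ with euclidsLemma c ∣ Z ∣ pp (subst (p ℕ.∣_) (abs-* (+ c) Z) (∣⇒∣ᵤ p∣cZ))
    ... | inj₁ p∣c = contradiction p∣c p∤c
    ... | inj₂ p∣Z = ∣ᵤ⇒∣ p∣Z

    p∤2 : ¬ p ℕ.∣ 2
    p∤2 p∣2 = ℕ.<⇒≱ 2<p (ℕ.∣⇒≤ p∣2)

    p∤4 : ¬ p ℕ.∣ 4
    p∤4 p∣4 with euclidsLemma 2 2 pp p∣4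
    ... | inj₁ p∣2 = p∤2 p∣2
    ... | inj₂ p∣2 = p∤2 p∣2

    p∤5 : ¬ p ℕ.∣ 5
    p∤5 p∣5 with prime⇒irreducible (from-yes (prime? 5)) p∣5
    ... | inj₁ refl = ℕ.<⇒≱ 2<p (s≤s z≤n)
    ... | inj₂ p≡5  = p≢5 p≡5

    +-mono₄-≤ : ∀ {a b c d a′ b′ c′ d′} → a ≤ a′ → b ≤ b′ → c ≤ c′ → d ≤ d′ →
                a ℕ.+ b ℕ.+ c ℕ.+ d ≤ a′ ℕ.+ b′ ℕ.+ c′ ℕ.+ d′
    +-mono₄-≤ a≤ b≤ c≤ d≤ = ℕ.+-mono-≤ (ℕ.+-mono-≤ (ℕ.+-mono-≤ a≤ b≤) c≤) d≤

    summand₁ : ∀ a b c d → a ≤ a ℕ.+ b ℕ.+ c ℕ.+ d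
    summand₁ a b c d = ℕ.≤-trans (ℕ.m≤m+n a b) (ℕ.≤-trans (ℕ.m≤m+n (a ℕ.+ b) c) (ℕ.m≤m+n _ d))

    summand₂ : ∀ a b c d → b ≤ a ℕ.+ b ℕ.+ c ℕ.+ d
    summand₂ a b c d = ℕ.≤-trans (ℕ.m≤n+m b a) (ℕ.≤-trans (ℕ.m≤m+n (a ℕ.+ b) c) (ℕ.m≤m+n _ d))

    summand₃ : ∀ a b c d → c ≤ a ℕ.+ b ℕ.+ c ℕ.+ d
    summand₃ a b c d = ℕ.≤-trans (ℕ.m≤n+m c (a ℕ.+ b)) (ℕ.m≤m+n (a ℕ.+ b ℕ.+ c) d)

    summand₄ : ∀ a b c d → d ≤ a ℕ.+ b ℕ.+ c ℕ.+ d
    summand₄ a b c d = ℕ.m≤n+m d (a ℕ.+ b ℕ.+ c)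

    δ[2A]≤positives : ∀ j A B → δ j (+ 2 * A) ≤ positives j A B
    δ[2A]≤positives j A B = summand₂ (δ j (+ 2 * A + + 2 * B)) (δ j (+ 2 * A)) (δ j (+ 2 * B)) (δ j 0ℤ)

    δ[0]≤positives : ∀ j A B → δ j 0ℤ ≤ positives j A B
    δ[0]≤positives j A B = summand₄ (δ j (+ 2 * A + + 2 * B)) (δ j (+ 2 * A)) (δ j (+ 2 * B)) (δ j 0ℤ)

    δ[2A+B]≤negatives : ∀ j A B → δ j (+ 2 * A + B) ≤ negatives j A B
    δ[2A+B]≤negatives j A B = summand₁ (δ j (+ 2 * A + B)) (δ j (A + + 2 * B)) (δ j A) (δ j B)

    δ[A]≤negatives : ∀ j A B → δ j A ≤ negatives j A B
    δ[A]≤negatives j A B = summand₃ (δ j (+ 2 * A + B)) (δ j (A + + 2 * B)) (δ j A) (δ j B)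

    δ[B]≤negatives : ∀ j A B → δ j B ≤ negatives j A B
    δ[B]≤negatives j A B = summand₄ (δ j (+ 2 * A + B)) (δ j (A + + 2 * B)) (δ j A) (δ j B)

    unbalanced : ∀ {l r} → l ≤ 1 → 2 ≤ r → l ≢ r
    unbalanced l≤1 2≤r refl = ℕ.<-irrefl refl (ℕ.≤-trans 2≤r l≤1)

    is-0 : ∀ {n} → n ≡ 0 → n ≤ 0
    is-0 = ℕ.≤-reflexive

    at-least : ∀ {m n} → m ≡ 1 → m ≤ n → 1 ≤ n
    at-least refl m≤n = m≤n

  -- In each case some residue class j carries at most one exponent on one side of the balance and
  -- at least two on the other.
  ¬balanced-generic : ∀ {X Y} → ¬ + p ∣ X → ¬ + p ∣ Y → ¬ + p ∣ + 2 * X + Y → ¬ + p ∣ X + + 2 * Y →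
                      ¬ Balanced X Y
  ¬balanced-generic {X} {Y} p∤X p∤Y p∤2X+Y p∤X+2Y balanced =
    unbalanced (ℕ.+-mono-≤ positives≤1 negatives≤0) (ℕ.+-mono-≤ positives≥1 negatives≥1) (balanced j (n%ℕd<d X p))
    where
    j : ℕ
    j = X %ℕ p
    positives≤1 : positives j X Y ≤ 1
    positives≤1 = +-mono₄-≤
      (is-0 (δ-∤ X (+ 2 * X + + 2 * Y) λ d → p∤X+2Y (∣-scale 1ℤ d (solve (X ∷ Y ∷ [])))))
      (is-0 (δ-∤ X (+ 2 * X) λ d → p∤X (∣-scale 1ℤ d (solve (X ∷ [])))))
      (δ≤1 j (+ 2 * Y))
      (is-0 (δ-∤ X 0ℤ λ d → p∤X (∣-scale -1ℤ d (solve (X ∷ [])))))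
    negatives≤0 : negatives 0 X Y ≤ 0
    negatives≤0 = +-mono₄-≤ (is-0 (δ₀-∤ _ p∤2X+Y)) (is-0 (δ₀-∤ _ p∤X+2Y))
                            (is-0 (δ₀-∤ X p∤X)) (is-0 (δ₀-∤ Y p∤Y))
    positives≥1 : 1 ≤ positives 0 X Y
    positives≥1 = at-least (δ₀-∣ (divides 0ℤ refl)) (δ[0]≤positives 0 X Y)
    negatives≥1 : 1 ≤ negatives j X Y
    negatives≥1 = at-least (δ-refl X) (δ[A]≤negatives j X Y)

  ¬balanced-one-divisible : ∀ {X Y} → + p ∣ X → ¬ + p ∣ Y → ¬ Balanced X Y
  ¬balanced-one-divisible {X} {Y} p∣X p∤Y balanced =
    unbalanced (ℕ.+-mono-≤ positives≤0 negatives≤1) (ℕ.+-mono-≤ positives≥1 negatives≥1) (balanced j (n%ℕd<d Y p))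
    where
    j : ℕ
    j = Y %ℕ p
    positives≤0 : positives j X Y ≤ 0
    positives≤0 = +-mono₄-≤
      (is-0 (δ-∤ Y (+ 2 * X + + 2 * Y) λ d → p∤Y (∣-combination 1ℤ (- + 2) d p∣X (solve (X ∷ Y ∷ [])))))
      (is-0 (δ-∤ Y (+ 2 * X) λ d → p∤Y (∣-combination -1ℤ (+ 2) d p∣X (solve (X ∷ Y ∷ [])))))
      (is-0 (δ-∤ Y (+ 2 * Y) λ d → p∤Y (∣-scale 1ℤ d (solve (Y ∷ [])))))
      (is-0 (δ-∤ Y 0ℤ λ d → p∤Y (∣-scale -1ℤ d (solve (Y ∷ [])))))
    negatives≤1 : negatives 0 X Y ≤ 1
    negatives≤1 = +-mono₄-≤
      (is-0 (δ₀-∤ (+ 2 * X + Y) λ d → p∤Y (∣-combination 1ℤ (- + 2) d p∣X (solve (X ∷ Y ∷ [])))))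
      (is-0 (δ₀-∤ (X + + 2 * Y) λ d →
        p∤Y (∣-cancel 2 p∤2 (∣-combination 1ℤ -1ℤ d p∣X (solve (X ∷ Y ∷ []))))))
      (δ≤1 0 X)
      (is-0 (δ₀-∤ Y p∤Y))
    positives≥1 : 1 ≤ positives 0 X Y
    positives≥1 = at-least (δ₀-∣ (divides 0ℤ refl)) (δ[0]≤positives 0 X Y)
    negatives≥1 : 1 ≤ negatives j X Y
    negatives≥1 = at-least (δ-refl Y) (δ[B]≤negatives j X Y)

  ¬balanced-2X+Y : ∀ {X Y} → ¬ + p ∣ X → ¬ + p ∣ Y → + p ∣ + 2 * X + Y → ¬ Balanced X Y
  ¬balanced-2X+Y {X} {Y} p∤X p∤Y p∣2X+Y balanced =
    unbalanced (ℕ.+-mono-≤ positives≤1 negatives≤0) (ℕ.+-mono-≤ positives≥1 negatives≥1)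
               (sym (balanced j (n%ℕd<d (+ 2 * X) p)))
    where
    j : ℕ
    j = (+ 2 * X) %ℕ p
    positives≤1 : positives 0 X Y ≤ 1
    positives≤1 = +-mono₄-≤
      (is-0 (δ₀-∤ (+ 2 * X + + 2 * Y) λ d → p∤Y (∣-combination 1ℤ -1ℤ d p∣2X+Y (solve (X ∷ Y ∷ [])))))
      (is-0 (δ₀-∤ (+ 2 * X) λ d → p∤X (∣-cancel 2 p∤2 d)))
      (is-0 (δ₀-∤ (+ 2 * Y) λ d → p∤Y (∣-cancel 2 p∤2 d)))
      (δ≤1 0 0ℤ)
    negatives≤0 : negatives j X Y ≤ 0
    negatives≤0 = +-mono₄-≤
      (is-0 (δ-∤ (+ 2 * X) (+ 2 * X + Y) λ d → p∤Y (∣-scale 1ℤ d (solve (X ∷ Y ∷ [])))))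
      (is-0 (δ-∤ (+ 2 * X) (X + + 2 * Y) λ d →
        p∤X (∣-cancel 5 p∤5 (∣-combination (+ 2) -1ℤ p∣2X+Y d (solve (X ∷ Y ∷ []))))))
      (is-0 (δ-∤ (+ 2 * X) X λ d → p∤X (∣-scale -1ℤ d (solve (X ∷ [])))))
      (is-0 (δ-∤ (+ 2 * X) Y λ d →
        p∤X (∣-cancel 4 p∤4 (∣-combination 1ℤ -1ℤ p∣2X+Y d (solve (X ∷ Y ∷ []))))))
    positives≥1 : 1 ≤ positives j X Y
    positives≥1 = at-least (δ-refl (+ 2 * X)) (δ[2A]≤positives j X Y)
    negatives≥1 : 1 ≤ negatives 0 X Y
    negatives≥1 = at-least (δ₀-∣ p∣2X+Y) (δ[2A+B]≤negatives 0 X Y)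

  ¬balanced : ∀ {A B} → ¬ ((+ p ∣ A) × (+ p ∣ B)) → ¬ Balanced A B
  ¬balanced {A} {B} ¬p∣A×B balanced with + p ∣? A | + p ∣? B
  ... | yes p∣A | yes p∣B = ¬p∣A×B (p∣A , p∣B)
  ... | yes p∣A | no  p∤B = ¬balanced-one-divisible p∣A p∤B balanced
  ... | no  p∤A | yes p∣B = ¬balanced-one-divisible p∣B p∤A (balanced-sym {A} {B} balanced)
  ... | no  p∤A | no  p∤B with + p ∣? + 2 * A + B | + p ∣? A + + 2 * B
  ...   | yes p∣2A+B | _          = ¬balanced-2X+Y p∤A p∤B p∣2A+B balanced
  ...   | no  _      | yes p∣A+2B =
    ¬balanced-2X+Y p∤B p∤A (subst (+ p ∣_) (+-comm A _) p∣A+2B) (balanced-sym {A} {B} balanced)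
  ...   | no  p∤2A+B | no  p∤A+2B = ¬balanced-generic p∤A p∤B p∤2A+B p∤A+2B balanced

module _ (Φ : ℕ → Poly) (cyclotomic : IsCyclotomicFamily Φ) where
  open Evaluation
  open SpecialPolynomials
  open Cyclotomic Φ cyclotomic
  open SignedMonomialSums
  open import Data.Nat as ℕ using ()
  import Data.Nat.Properties as ℕ
  open import Data.Nat.Divisibility using (_∣_; _∣0; m∣m*n; ∣m∣n⇒∣m+n; ∣⇒≤)
  open import Data.Nat.Primality using (prime⇒nonZero; euclidsLemma)
  open import Data.Integer using (+_; -_; _*_; 1ℤ)
  open import Data.Integer.Properties using (neg-involutive; *-comm; ^-zeroˡ)
  open import Data.Integer.Divisibility.Signed using (divides; ∣⇒∣ᵤ)
  open import Data.List using (length)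
  open import Data.List.Relation.Unary.All using ([]; _∷_; tabulate)
  open import Data.Product using (_×_; _,_)
  open import Data.Sum using (inj₁; inj₂)
  open import Function using (_∘_)
  open import Relation.Nullary using (¬_)
  open import Relation.Binary.PropositionalEquality
    using (_≡_; refl; cong; cong₂; sym; trans; module ≡-Reasoning)

  eval-additive : ∀ t → Additive (eval t)
  eval-additive t = record { +ₚ-homo = eval-+ₚ t ; -ₚ-homo = eval-minusₚ t }

  R-at-1 : ∀ a b → eval 1ℤ (R a b) ≡ + 8
  R-at-1 a b = trans (additive-monomialSum (eval-additive 1ℤ) (2 ℕ.* a ℕ.+ 2 ℕ.* b) (R-monomials a b))
                     (signedSum-cong (eval 1ℤ ∘ X^) (λ _ → 1ℤ) (2 ℕ.* a ℕ.+ 2 ℕ.* b) (R-monomials a b)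
                       (1^ (2 ℕ.* a ℕ.+ 2 ℕ.* b)) (tabulate λ {(_ , e)} _ → 1^ e))
    where
    1^ : ∀ e → eval 1ℤ (X^ e) ≡ 1ℤ
    1^ e = trans (eval-X^ 1ℤ e) (^-zeroˡ e)

  Φ-prime∤R : ∀ {p} → Prime p → 2 < p → ∀ a b → ¬ Φ p ∣ₚ R a b
  Φ-prime∤R {p} pp 2<p a b (q , Φₚq≈R) = p∤8 p∣8
    where
    8≡q[1]*p : + 8 ≡ eval 1ℤ q * + p
    8≡q[1]*p = begin
      + 8                             ≡⟨ sym (R-at-1 a b) ⟩
      eval 1ℤ (R a b)                 ≡⟨ sym (eval-cong 1ℤ (Φ p *ₚ q) (R a b) Φₚq≈R) ⟩
      eval 1ℤ (Φ p *ₚ q)              ≡⟨ eval-*ₚ 1ℤ (Φ p) q ⟩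
      eval 1ℤ (Φ p) * eval 1ℤ q       ≡⟨ cong (_* eval 1ℤ q) (eval-Φ-prime-1 pp) ⟩
      + p * eval 1ℤ q                 ≡⟨ *-comm (+ p) _ ⟩
      eval 1ℤ q * + p                 ∎
      where open ≡-Reasoning
    p∣8 : p ∣ 8
    p∣8 = ∣⇒∣ᵤ (divides (eval 1ℤ q) 8≡q[1]*p)
    p∤2 : ¬ p ∣ 2
    p∤2 p∣2 = ℕ.<⇒≱ 2<p (∣⇒≤ p∣2)
    p∤8 : ¬ p ∣ 8
    p∤8 p∣8 with euclidsLemma 2 4 pp p∣8
    ... | inj₁ p∣2 = p∤2 p∣2
    ... | inj₂ p∣4 with euclidsLemma 2 2 pp p∣4
    ...   | inj₁ p∣2 = p∤2 p∣2
    ...   | inj₂ p∣2 = p∤2 p∣2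

  Q-even : ∀ {a b} → 2 ∣ a → 2 ∣ b → ∀ t → eval (- t) (Q a b) ≡ eval t (Q a b)
  Q-even {a} {b} 2∣a 2∣b t = begin
    eval (- t) (Q a b)                       ≡⟨ additive-monomialSum (eval-additive (- t)) deg (Q-monomials a b) ⟩
    signedSum (eval (- t) ∘ X^) deg (Q-monomials a b)
      ≡⟨ signedSum-cong (eval (- t) ∘ X^) (eval t ∘ X^) deg (Q-monomials a b) (even (∣m∣n⇒∣m+n 2∣2a 2∣2b))
                        (even 2∣2a ∷ even 2∣2b ∷ even (2 ∣0) ∷ even (∣m∣n⇒∣m+n 2∣2a 2∣b)
                          ∷ even (∣m∣n⇒∣m+n 2∣a 2∣2b) ∷ even 2∣a ∷ even 2∣b ∷ []) ⟩
    signedSum (eval t ∘ X^) deg (Q-monomials a b)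
      ≡⟨ sym (additive-monomialSum (eval-additive t) deg (Q-monomials a b)) ⟩
    eval t (Q a b)                           ∎
    where
    open ≡-Reasoning
    deg : ℕ
    deg = 2 ℕ.* a ℕ.+ 2 ℕ.* b
    2∣2a : 2 ∣ 2 ℕ.* a
    2∣2a = m∣m*n a
    2∣2b : 2 ∣ 2 ℕ.* b
    2∣2b = m∣m*n b
    even : ∀ {e} → 2 ∣ e → eval (- t) (X^ e) ≡ eval t (X^ e)
    even {e} 2∣e = trans (eval-X^ (- t) e) (trans (^-neg-even t 2∣e) (sym (eval-X^ t e)))

  Φ-2*prime∣Q⇒geometric∣Q : ∀ {p a b q} → Prime p → 2 < p → 2 ∣ a → 2 ∣ b →
                             Φ (2 ℕ.* p) *ₚ q ≈ₚ Q a b → Q a b ≈ₚ geometric p *ₚ alt q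
  Φ-2*prime∣Q⇒geometric∣Q {p} {a} {b} {q} pp 2<p 2∣a 2∣b Φ₂ₚq≈Q =
    ≈ₚ-fromEval (Q a b) (geometric p *ₚ alt q) (λ m → at (+ (2 ℕ.+ m)))
    where
    open ≡-Reasoning
    at : ∀ s → eval s (Q a b) ≡ eval s (geometric p *ₚ alt q)
    at s = begin
      eval s (Q a b)                                ≡⟨ sym (Q-even 2∣a 2∣b s) ⟩
      eval (- s) (Q a b)                            ≡⟨ eval-cong (- s) (Q a b) (Φ (2 ℕ.* p) *ₚ q) (sym ∘ Φ₂ₚq≈Q) ⟩
      eval (- s) (Φ (2 ℕ.* p) *ₚ q)                 ≡⟨ eval-*ₚ (- s) (Φ (2 ℕ.* p)) q ⟩
      eval (- s) (Φ (2 ℕ.* p)) * eval (- s) q       ≡⟨ cong₂ _*_ Φ₂ₚ[-s] (sym (eval-alt s q)) ⟩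
      eval s (geometric p) * eval s (alt q)         ≡⟨ sym (eval-*ₚ s (geometric p) (alt q)) ⟩
      eval s (geometric p *ₚ alt q)                 ∎
      where
      Φ₂ₚ[-s] : eval (- s) (Φ (2 ℕ.* p)) ≡ eval s (geometric p)
      Φ₂ₚ[-s] = begin
        eval (- s) (Φ (2 ℕ.* p))
          ≡⟨ eval-cong (- s) (Φ (2 ℕ.* p)) (alt (geometric p)) (Φ-2*prime≈alt-geometric pp 2<p) ⟩
        eval (- s) (alt (geometric p))     ≡⟨ eval-alt (- s) (geometric p) ⟩
        eval (- - s) (geometric p)         ≡⟨ cong (λ t → eval t (geometric p)) (neg-involutive s) ⟩
        eval s (geometric p)               ∎

  Φ-2*prime∤Q : ∀ {p} → Prime p → 2 < p → p ≢ 5 →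
                ∀ {a b} → 2 ∣ a → 2 ∣ b → ¬ (p ∣ a × p ∣ b) → ¬ Φ (2 ℕ.* p) ∣ₚ Q a b
  Φ-2*prime∤Q {p} pp 2<p p≢5 {a} {b} 2∣a 2∣b ¬p∣a×b (q , Φ₂ₚq≈Q) =
    ¬balanced {+ a} {+ b} (λ (p∣a , p∣b) → ¬p∣a×b (∣⇒∣ᵤ p∣a , ∣⇒∣ᵤ p∣b))
      (classSum-constant⇒balanced K a b (ℕ.m≤m+n _ _)
        (classSum-constant (Q a b) (alt q) K shift-identity (ℕ.m≤n+m _ _)))
    where
    open ResidueClassSums p {{prime⇒nonZero pp}} using (classSum-constant)
    open ResidueCounting pp 2<p p≢5 using (¬balanced; classSum-constant⇒balanced)
    K : ℕ
    K = 2 ℕ.* a ℕ.+ 2 ℕ.* b ℕ.+ length (alt q)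
    shift-identity : shift 1 (Q a b) -ₚ Q a b ≈ₚ shift p (alt q) -ₚ alt q
    shift-identity = [x-1]f≈[xⁿ-1]g p (Q a b) (alt q) (Φ-2*prime∣Q⇒geometric∣Q pp 2<p 2∣a 2∣b Φ₂ₚq≈Q)

open import Data.Nat using (ℕ; _+_; _*_; _∸_; _≤_; _<_; _/_; _%_)
open import Data.Nat.Properties using (≤-trans; m≤m+n; <-trans; n<1+n; <⇒≱; >⇒≢)
open import Data.Nat.Divisibility using (_∣_; divides; ∣⇒≤; ∣1⇒≡1)
open import Data.Nat.DivMod using (m*n/n≡m)
open import Data.Nat.GCD using (gcd; gcd-greatest)
open import Data.Nat.Primality using (Prime; euclidsLemma)
open import Data.Product using (_×_; _,_)
open import Data.Sum using (_⊎_; inj₁; inj₂)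
open import Relation.Nullary using (¬_; contradiction)
open import Relation.Binary.PropositionalEquality using (_≡_; _≢_; refl; subst; sym)

odd-prime∣⇒∣half : ∀ {p m} → Prime p → 2 < p → p ∣ m → 2 ∣ m → p ∣ m / 2
odd-prime∣⇒∣half {p} pp 2<p p∣m (divides k refl) with euclidsLemma k 2 pp p∣m
... | inj₁ p∣k = subst (p ∣_) (sym (m*n/n≡m k 2)) p∣k
... | inj₂ p∣2 = contradiction (∣⇒≤ p∣2) (<⇒≱ 2<p)

lemma3p5 : (Φ : ℕ → Poly) → IsCyclotomicFamily Φ →
    (m a b : ℕ) → 4 ≤ m → 2 ∣ m → 1 ≤ a → a ≤ b → 2 * b < m →
    m % 4 ≡ 2 →
    2 ∣ a → 2 ∣ b →
    gcd (gcd (m / 2) a) b ≡ 1 →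
    (5 ∣ m → 5 ∣ a ⊎ 5 ∣ b ⊎ 5 ∣ (b ∸ a) ⊎ 5 ∣ (a + b)) →
    (p : ℕ) → Prime p → 11 ≤ p → p ∣ m →
    ¬ (Φ p ∣ₚ R a b) × ¬ (Φ (2 * p) ∣ₚ Q a b)
lemma3p5 Φ cyclotomic m a b _ 2∣m _ _ _ _ 2∣a 2∣b gcd≡1 _ p pp 11≤p p∣m =
  Φ-prime∤R Φ cyclotomic pp 2<p a b , Φ-2*prime∤Q Φ cyclotomic pp 2<p p≢5 2∣a 2∣b p∤gcd
  where
  2<p : 2 < p
  2<p = ≤-trans (m≤m+n 3 8) 11≤p
  p≢5 : p ≢ 5
  p≢5 = >⇒≢ (≤-trans (m≤m+n 6 5) 11≤p)
  p∤gcd : ¬ (p ∣ a × p ∣ b)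
  p∤gcd (p∣a , p∣b) = >⇒≢ (<-trans (n<1+n 1) 2<p) (∣1⇒≡1 (subst (p ∣_) gcd≡1 p∣gcd))
    where
    p∣gcd : p ∣ gcd (gcd (m / 2) a) b
    p∣gcd = gcd-greatest (gcd-greatest (odd-prime∣⇒∣half pp 2<p p∣m 2∣m) p∣a) p∣b
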